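{- Let $\gamma\ge 0$ and $\delta>0$ be integers, and put $m=(16^{\delta}4^{\gamma}-4^{\delta+\gamma})/6$ and $n=(4^{\delta+\gamma}-1)/3$. Let $A^*$ be the $(\gamma+\delta)\times m$ matrix over $\mathbb{E}_4$ whose columns are (in any order) all columns $a\in\mathbb{E}_4^{\gamma+\delta}$ such that: (i) $a$ has additive order $4$ (i.e. some entry of $a$ is a regular element, not a zero divisor); (ii) the first regular entry of $a$ equals $1$ or $\psi=2+\omega$; (iii) the last $\gamma$ entries of $a$ are zero divisors (i.e. lie in $\{0,2,2\omega,2\bar\omega\}$). Let $A'$ be the $(\gamma+\delta)\times n$ matrix over $\mathbb{E}_2$ whose columns are all nonzero columns of $\mathbb{E}_2^{\gamma+\delta}$ whose first nonzero entry is $1$. For $z=(x\mid y)\in\mathbb{E}_4^m\times\mathbb{E}_2^n$ define $Az^{\mathrm T}=A^*x^{\mathrm T}+2A'y^{\mathrm T}\in\mathbb{E}_4^{\gamma+\delta}$, where $2A'y^{\mathrm T}$ is regarded as a column over $\mathbb{E}_4$ (the map $u\mapsto 2u$ from $\mathbb{E}_2$ to $\mathbb{E}_4$ being well defined). Then $C=\{c\in\mathbb{E}_4^m\times\mathbb{E}_2^n: Ac^{\mathrm T}=\bar 0^{\mathrm T}\}$ is a linear $1$-perfect code in the Doob graph $D(m,n)$.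
   Context: $\mathbb{E}=\{a+b\omega: a,b\in\mathbb{Z}\}$, $\omega=e^{2\pi i/3}$, are the Eisenstein integers; $\mathbb{E}_4=\mathbb{E}/4\mathbb{E}$ (the Galois ring $\mathrm{GR}(4^2)$) and $\mathbb{E}_2=\mathbb{E}/2\mathbb{E}=\mathrm{GF}(4)$; $\bar\omega=\omega^2$. The zero divisors of $\mathbb{E}_4$ are $0,2,2\omega,2\bar\omega$; all other elements are regular. Let $\mathcal{E}=\{\pm1,\pm\omega,\pm\bar\omega\}\subset\mathbb{E}_4$. The Shrikhande graph is the Cayley graph of $(\mathbb{E}_4,+)$ with generating set $\mathcal{E}$; $K$ is the Cayley graph of $(\mathbb{E}_2,+)$ with generating set $\{1,\omega,\bar\omega\}$ (the complete graph on 4 vertices). The Doob graph $D(m,n)$ (for $m>0$) is the Cartesian product of $m$ Shrikhande graphs and $n$ copies of $K$, with vertex set $\mathbb{E}_4^m\times\mathbb{E}_2^n$. This set is an $\mathbb{E}_4$-module coordinatewise ($\mathbb{E}_4$ acting on $\mathbb{E}_2$ via reduction mod 2); a code is linear if it is a submodule. A $1$-perfect code is a vertex set whose radius-$1$ balls partition the vertex set. -}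

module Defs where

open import Data.Nat using (ℕ; zero; suc; _+_; _*_; _∸_; _^_; _/_; _≤_; _<_)
open import Data.Nat.DivMod using (_mod_)
open import Data.Fin using (Fin; toℕ; fromℕ<)
open import Data.Fin.Patterns using (0F; 1F; 2F; 3F)
open import Data.Product using (Σ; _×_; _,_; ∃; proj₁; proj₂)
open import Data.Sum using (_⊎_)
open import Data.Vec using (Vec; lookup; tabulate; updateAt; replicate; zipWith; map)
open import Relation.Binary.PropositionalEquality using (_≡_)
open import Relation.Nullary using (¬_)

Z4 : Set
Z4 = Fin 4

Z2 : Set
Z2 = Fin 2

-- Eisenstein integers mod 4: (a , b) represents a + b ω
E4 : Set
E4 = Z4 × Z4

-- Eisenstein integers mod 2 (= GF(4)): (a , b) represents a + b ω
E2 : Set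
E2 = Z2 × Z2

infixl 6 _+₄_ _+₂_
infixl 7 _*₄_ _*₂_

_+₄_ : E4 → E4 → E4
(a , b) +₄ (c , d) = ((toℕ a + toℕ c) mod 4) , ((toℕ b + toℕ d) mod 4)

-- (a + bω)(c + dω) = (ac − bd) + (ad + bc − bd) ω, using ω² = −1 − ω
_*₄_ : E4 → E4 → E4
(a , b) *₄ (c , d) =
  ((toℕ a * toℕ c + 3 * (toℕ b * toℕ d)) mod 4) ,
  ((toℕ a * toℕ d + toℕ b * toℕ c + 3 * (toℕ b * toℕ d)) mod 4)

_+₂_ : E2 → E2 → E2
(a , b) +₂ (c , d) = ((toℕ a + toℕ c) mod 2) , ((toℕ b + toℕ d) mod 2)

_*₂_ : E2 → E2 → E2
(a , b) *₂ (c , d) =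
  ((toℕ a * toℕ c + toℕ b * toℕ d) mod 2) ,
  ((toℕ a * toℕ d + toℕ b * toℕ c + toℕ b * toℕ d) mod 2)

0₄ 1₄ ω₄ ω̄₄ ψ : E4
0₄ = 0F , 0F
1₄ = 1F , 0F
ω₄ = 0F , 1F
ω̄₄ = 3F , 3F        -- ω² = −1 − ω
ψ = 2F , 1F

neg₄ : E4 → E4
neg₄ x = (3F , 0F) *₄ x

0₂ 1₂ ω₂ ω̄₂ : E2
0₂ = 0F , 0F
1₂ = 1F , 0F
ω₂ = 0F , 1F
ω̄₂ = 1F , 1F

-- reduction mod 2 : E4 → E2 (the E4-action on E2)
red : E4 → E2
red (a , b) = (toℕ a mod 2) , (toℕ b mod 2)

twice : E2 → E4
twice (a , b) = ((2 * toℕ a) mod 4) , ((2 * toℕ b) mod 4)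

ZeroDivisor : E4 → Set
ZeroDivisor x = x ≡ (0F , 0F) ⊎ x ≡ (2F , 0F) ⊎ x ≡ (0F , 2F) ⊎ x ≡ (2F , 2F)

Regular : E4 → Set
Regular x = ¬ ZeroDivisor x

-- generating set ℰ = {±1, ±ω, ±ω̄} of the Shrikhande graph
InGenE : E4 → Set
InGenE x = x ≡ 1₄ ⊎ x ≡ neg₄ 1₄ ⊎ x ≡ ω₄ ⊎ x ≡ neg₄ ω₄ ⊎ x ≡ ω̄₄ ⊎ x ≡ neg₄ ω̄₄

-- generating set {1, ω, ω̄} of K
InGenK : E2 → Set
InGenK x = x ≡ 1₂ ⊎ x ≡ ω₂ ⊎ x ≡ ω̄₂

sum₄ : (m : ℕ) → (Fin m → E4) → E4
sum₄ m f = Data.Vec.foldr _ _+₄_ 0₄ (tabulate f)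

sum₂ : (n : ℕ) → (Fin n → E2) → E2
sum₂ n f = Data.Vec.foldr _ _+₂_ 0₂ (tabulate f)

mSize : ℕ → ℕ → ℕ
mSize γ δ = (16 ^ δ * 4 ^ γ ∸ 4 ^ (δ + γ)) / 6

nSize : ℕ → ℕ → ℕ
nSize γ δ = (4 ^ (δ + γ) ∸ 1) / 3

-- columns a ∈ E4^(γ+δ), entry 0 being the first:
-- (i)+(ii): some entry is regular, and the first regular entry is 1 or ψ;
-- (iii): the last γ entries (indices ≥ δ) are zero divisors.
ValidColA* : (γ δ : ℕ) → Vec E4 (γ + δ) → Set
ValidColA* γ δ a =
  (Σ (Fin (γ + δ)) λ i →
     Regular (lookup a i) ×
     (∀ (j : Fin (γ + δ)) → toℕ j < toℕ i → ZeroDivisor (lookup a j)) ×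
     (lookup a i ≡ 1₄ ⊎ lookup a i ≡ ψ)) ×
  (∀ (j : Fin (γ + δ)) → δ ≤ toℕ j → ZeroDivisor (lookup a j))

ValidColA' : (γ δ : ℕ) → Vec E2 (γ + δ) → Set
ValidColA' γ δ a =
  Σ (Fin (γ + δ)) λ i →
    lookup a i ≡ 1₂ ×
    (∀ (j : Fin (γ + δ)) → toℕ j < toℕ i → lookup a j ≡ 0₂)

ColumnsEnumerate : {X : Set} {k : ℕ} (N : ℕ) → (Vec X k → Set) → (Fin N → Vec X k) → Set
ColumnsEnumerate N P col =
  (∀ i j → col i ≡ col j → i ≡ j) ×
  (∀ j → P (col j)) ×
  (∀ a → P a → ∃ λ j → col j ≡ a)

Vertex : ℕ → ℕ → Set
Vertex m n = Vec E4 m × Vec E2 n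

-- Cartesian product of Cayley graphs: add one generator in one coordinate
Adjacent : {m n : ℕ} → Vertex m n → Vertex m n → Set
Adjacent {m} {n} (x , y) (x' , y') =
  (Σ (Fin m) λ i → Σ E4 λ g → InGenE g × x' ≡ updateAt x i (_+₄ g) × y' ≡ y) ⊎
  (Σ (Fin n) λ i → Σ E2 λ g → InGenK g × y' ≡ updateAt y i (_+₂ g) × x' ≡ x)

InBall1 : {m n : ℕ} → Vertex m n → Vertex m n → Set
InBall1 c v = v ≡ c ⊎ Adjacent c v

IsPerfect1 : {m n : ℕ} → (Vertex m n → Set) → Set
IsPerfect1 {m} {n} C =
  ∀ (v : Vertex m n) →
    (∃ λ c → C c × InBall1 c v) ×
    (∀ c c' → C c → C c' → InBall1 c v → InBall1 c' v → c ≡ c')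

_⊕_ : {m n : ℕ} → Vertex m n → Vertex m n → Vertex m n
(x , y) ⊕ (x' , y') = zipWith _+₄_ x x' , zipWith _+₂_ y y'

_⊙_ : {m n : ℕ} → E4 → Vertex m n → Vertex m n
r ⊙ (x , y) = map (r *₄_) x , map (red r *₂_) y

-- linear code = E4-submodule
IsLinear : {m n : ℕ} → (Vertex m n → Set) → Set
IsLinear {m} {n} C =
  C (replicate m 0₄ , replicate n 0₂) ×
  (∀ u v → C u → C v → C (u ⊕ v)) ×
  (∀ r u → C u → C (r ⊙ u))

syndrome : (k m n : ℕ) → (Fin m → Vec E4 k) → (Fin n → Vec E2 k) →
           Vertex m n → Vec E4 k
syndrome k m n colA* colA' (x , y) = tabulate λ r →
  sum₄ m (λ j → lookup (colA* j) r *₄ lookup x j) +₄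
  twice (sum₂ n (λ j → lookup (colA' j) r *₂ lookup y j))

CodeC : (k m n : ℕ) → (Fin m → Vec E4 k) → (Fin n → Vec E2 k) →
        Vertex m n → Set
CodeC k m n colA* colA' z = syndrome k m n colA* colA' z ≡ replicate k 0₄

module Submission where

-- The code C is the kernel of the check map z ↦ A zᵀ, so the proof is the
-- classical syndrome argument for 1-perfect codes.
--
-- * Linearity: each syndrome entry is an E4-linear function of the vertex
--   (module Dot: dot products over a commutative monoid with a left
--   multiplication), so the kernel is a submodule.
-- * Perfectness: an "error" is either nothing, a generator g ∈ ℰ added in a
--   Shrikhande coordinate i, or a generator h of K added in a K-coordinate j;
--   its syndrome is 0, g·(column i of A*) or 2h·(column j of A'), respectively.
--   A codeword c lies in the ball of v iff v = c + e for an error e, and then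
--   syn v = syn e (module Syndromes).  Hence it suffices that every syndrome of a
--   vertex is the syndrome of exactly one error (module Decoding):
--   existence by scaling the syndrome column to an admissible column (its first
--   regular entry to 1 or ψ, or, if all entries are zero divisors, the first
--   nonzero entry of its half to 1); uniqueness because the first regular
--   (resp. nonzero) position of an error syndrome is the pivot of its column.

open import Defs
open import Data.Nat using (ℕ; zero; suc; _<_; _≤_; _+_; s≤s)
open import Data.Fin using (Fin; zero; suc; toℕ; _≟_)
open import Data.Fin.Patterns using (0F; 1F; 2F; 3F)
open import Data.Fin.Properties using (all?; any?; <-cmp; suc-injective)
open import Data.Product using (Σ; ∃; _×_; _,_; proj₁; proj₂)
open import Data.Product.Properties using (≡-dec)
open import Data.Sum using (_⊎_; inj₁; inj₂)
open import Data.Unit using (⊤; tt)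
open import Data.Empty using (⊥-elim)
open import Data.Vec using (Vec; lookup; tabulate; updateAt; replicate; zipWith; map; foldr)
open import Data.Vec.Properties
  using (lookup∘tabulate; tabulate∘lookup; tabulate-cong; lookup-replicate; lookup-zipWith;
         lookup-map; lookup∘updateAt; lookup∘updateAt′; updateAt-updateAt-local; updateAt-id)
open import Function using (_∘_)
open import Relation.Nullary using (Dec; yes; no; ¬_; ¬?)
open import Relation.Nullary.Decidable using (from-yes; map′; _→-dec_; _⊎-dec_; _×-dec_; decidable-stable)
open import Relation.Unary using (Decidable)
open import Relation.Binary using (tri<; tri≈; tri>)
open import Relation.Binary.PropositionalEquality
open ≡-Reasoning

_≟ₚ_ : ∀ {a b} (x y : Fin a × Fin b) → Dec (x ≡ y)
_≟ₚ_ = ≡-dec _≟_ _≟_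

∀-pair? : ∀ {a b} {P : Fin a × Fin b → Set} → Decidable P → Dec (∀ x → P x)
∀-pair? P? = map′ (λ f x → f (proj₁ x) (proj₂ x)) (λ f u v → f (u , v))
                  (all? λ u → all? λ v → P? (u , v))

∃-pair? : ∀ {a b} {P : Fin a × Fin b → Set} → Decidable P → Dec (∃ P)
∃-pair? P? = map′ (λ (u , v , p) → (u , v) , p) (λ ((u , v) , p) → u , v , p)
                  (any? λ u → any? λ v → P? (u , v))

PivotValue : E4 → Set
PivotValue a = a ≡ 1₄ ⊎ a ≡ ψ

zeroDivisor? : Decidable ZeroDivisor
zeroDivisor? x = (x ≟ₚ (0F , 0F)) ⊎-dec (x ≟ₚ (2F , 0F)) ⊎-dec (x ≟ₚ (0F , 2F)) ⊎-dec (x ≟ₚ (2F , 2F))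

regular? : Decidable Regular
regular? x = ¬? (zeroDivisor? x)

inGenE? : Decidable InGenE
inGenE? x = (x ≟ₚ 1₄) ⊎-dec (x ≟ₚ neg₄ 1₄) ⊎-dec (x ≟ₚ ω₄) ⊎-dec (x ≟ₚ neg₄ ω₄) ⊎-dec (x ≟ₚ ω̄₄) ⊎-dec (x ≟ₚ neg₄ ω̄₄)

inGenK? : Decidable InGenK
inGenK? x = (x ≟ₚ 1₂) ⊎-dec (x ≟ₚ ω₂) ⊎-dec (x ≟ₚ ω̄₂)

pivotValue? : Decidable PivotValue
pivotValue? x = (x ≟ₚ 1₄) ⊎-dec (x ≟ₚ ψ)

¬regular⇒zeroDivisor : ∀ x → ¬ Regular x → ZeroDivisor x
¬regular⇒zeroDivisor x = decidable-stable (zeroDivisor? x)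

-- Halving on E4, a left inverse of twice on the zero divisors 2E4.
half : E4 → E2
half (a , b) = halve a , halve b
  where
  halve : Fin 4 → Fin 2
  halve 0F = 0F
  halve 1F = 0F
  halve 2F = 1F
  halve 3F = 1F

ScalarDetermined : E4 → E4 → Set
ScalarDetermined a a' = ∀ g g' → InGenE g → InGenE g' → a *₄ g ≡ a' *₄ g' → g ≡ g'

scalarDetermined? : ∀ a a' → Dec (ScalarDetermined a a')
scalarDetermined? a a' = ∀-pair? λ g → ∀-pair? λ g' →
  inGenE? g →-dec (inGenE? g' →-dec (((a *₄ g) ≟ₚ (a' *₄ g')) →-dec (g ≟ₚ g')))

-- Facts about E4 and E2, each verified by evaluating a decision procedure
-- over all elements (kept abstract so that the witnesses are never unfolded).
abstract
  +₄-assoc : ∀ x y z → (x +₄ y) +₄ z ≡ x +₄ (y +₄ z)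
  +₄-assoc = from-yes (∀-pair? λ x → ∀-pair? λ y → ∀-pair? λ z → ((x +₄ y) +₄ z) ≟ₚ (x +₄ (y +₄ z)))

  +₄-comm : ∀ x y → x +₄ y ≡ y +₄ x
  +₄-comm = from-yes (∀-pair? λ x → ∀-pair? λ y → (x +₄ y) ≟ₚ (y +₄ x))

  +₄-identityˡ : ∀ x → 0₄ +₄ x ≡ x
  +₄-identityˡ = from-yes (∀-pair? λ x → (0₄ +₄ x) ≟ₚ x)

  *₄-distribˡ : ∀ c x y → c *₄ (x +₄ y) ≡ c *₄ x +₄ c *₄ y
  *₄-distribˡ = from-yes (∀-pair? λ c → ∀-pair? λ x → ∀-pair? λ y → (c *₄ (x +₄ y)) ≟ₚ (c *₄ x +₄ c *₄ y))

  *₄-zeroʳ : ∀ c → c *₄ 0₄ ≡ 0₄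
  *₄-zeroʳ = from-yes (∀-pair? λ c → (c *₄ 0₄) ≟ₚ 0₄)

  *₄-left-comm : ∀ a c x → a *₄ (c *₄ x) ≡ c *₄ (a *₄ x)
  *₄-left-comm = from-yes (∀-pair? λ a → ∀-pair? λ c → ∀-pair? λ x → (a *₄ (c *₄ x)) ≟ₚ (c *₄ (a *₄ x)))

  +₂-assoc : ∀ x y z → (x +₂ y) +₂ z ≡ x +₂ (y +₂ z)
  +₂-assoc = from-yes (∀-pair? λ x → ∀-pair? λ y → ∀-pair? λ z → ((x +₂ y) +₂ z) ≟ₚ (x +₂ (y +₂ z)))

  +₂-comm : ∀ x y → x +₂ y ≡ y +₂ x
  +₂-comm = from-yes (∀-pair? λ x → ∀-pair? λ y → (x +₂ y) ≟ₚ (y +₂ x))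

  +₂-identityˡ : ∀ x → 0₂ +₂ x ≡ x
  +₂-identityˡ = from-yes (∀-pair? λ x → (0₂ +₂ x) ≟ₚ x)

  *₂-distribˡ : ∀ c x y → c *₂ (x +₂ y) ≡ c *₂ x +₂ c *₂ y
  *₂-distribˡ = from-yes (∀-pair? λ c → ∀-pair? λ x → ∀-pair? λ y → (c *₂ (x +₂ y)) ≟ₚ (c *₂ x +₂ c *₂ y))

  *₂-zeroʳ : ∀ c → c *₂ 0₂ ≡ 0₂
  *₂-zeroʳ = from-yes (∀-pair? λ c → (c *₂ 0₂) ≟ₚ 0₂)

  *₂-left-comm : ∀ a c x → a *₂ (c *₂ x) ≡ c *₂ (a *₂ x)
  *₂-left-comm = from-yes (∀-pair? λ a → ∀-pair? λ c → ∀-pair? λ x → (a *₂ (c *₂ x)) ≟ₚ (c *₂ (a *₂ x)))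

  *₂-identityˡ : ∀ h → 1₂ *₂ h ≡ h
  *₂-identityˡ = from-yes (∀-pair? λ h → (1₂ *₂ h) ≟ₚ h)

  *₂-zeroˡ : ∀ h → 0₂ *₂ h ≡ 0₂
  *₂-zeroˡ = from-yes (∀-pair? λ h → (0₂ *₂ h) ≟ₚ 0₂)

  +₄-neg-cancel : ∀ x g → (x +₄ g) +₄ neg₄ g ≡ x
  +₄-neg-cancel = from-yes (∀-pair? λ x → ∀-pair? λ g → ((x +₄ g) +₄ neg₄ g) ≟ₚ x)

  neg-+₄-cancel : ∀ x g → (x +₄ neg₄ g) +₄ g ≡ x
  neg-+₄-cancel = from-yes (∀-pair? λ x → ∀-pair? λ g → ((x +₄ neg₄ g) +₄ g) ≟ₚ x)

  *₄-neg-cancel : ∀ a g → a *₄ g +₄ a *₄ neg₄ g ≡ 0₄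
  *₄-neg-cancel = from-yes (∀-pair? λ a → ∀-pair? λ g → (a *₄ g +₄ a *₄ neg₄ g) ≟ₚ 0₄)

  +₂-self-cancel : ∀ y h → (y +₂ h) +₂ h ≡ y
  +₂-self-cancel = from-yes (∀-pair? λ y → ∀-pair? λ h → ((y +₂ h) +₂ h) ≟ₚ y)

  twice-+ : ∀ u w → twice (u +₂ w) ≡ twice u +₄ twice w
  twice-+ = from-yes (∀-pair? λ u → ∀-pair? λ w → twice (u +₂ w) ≟ₚ (twice u +₄ twice w))

  twice-scale : ∀ c u → twice (red c *₂ u) ≡ c *₄ twice u
  twice-scale = from-yes (∀-pair? λ c → ∀-pair? λ u → twice (red c *₂ u) ≟ₚ (c *₄ twice u))

  twice-injective : ∀ u w → twice u ≡ twice w → u ≡ w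
  twice-injective = from-yes (∀-pair? λ u → ∀-pair? λ w → (twice u ≟ₚ twice w) →-dec (u ≟ₚ w))

  twice-self-cancel : ∀ u → twice u +₄ twice u ≡ 0₄
  twice-self-cancel = from-yes (∀-pair? λ u → (twice u +₄ twice u) ≟ₚ 0₄)

  twice-zeroDivisor : ∀ u → ZeroDivisor (twice u)
  twice-zeroDivisor = from-yes (∀-pair? λ u → zeroDivisor? (twice u))

  twice-half : ∀ x → ZeroDivisor x → twice (half x) ≡ x
  twice-half = from-yes (∀-pair? λ x → zeroDivisor? x →-dec (twice (half x) ≟ₚ x))

  zeroDivisor-+ : ∀ x y → ZeroDivisor x → ZeroDivisor y → ZeroDivisor (x +₄ y)
  zeroDivisor-+ = from-yes (∀-pair? λ x → ∀-pair? λ y → zeroDivisor? x →-dec (zeroDivisor? y →-dec zeroDivisor? (x +₄ y)))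

  zeroDivisor-*ʳ : ∀ x y → ZeroDivisor x → ZeroDivisor (x *₄ y)
  zeroDivisor-*ʳ = from-yes (∀-pair? λ x → ∀-pair? λ y → zeroDivisor? x →-dec zeroDivisor? (x *₄ y))

  -- ℰ consists of units: multiplying by it preserves regularity and cancels.
  regular-*-gen : ∀ x g → Regular x → InGenE g → Regular (x *₄ g)
  regular-*-gen = from-yes (∀-pair? λ x → ∀-pair? λ g → regular? x →-dec (inGenE? g →-dec regular? (x *₄ g)))

  gen-cancel : ∀ g x y → InGenE g → x *₄ g ≡ y *₄ g → x ≡ y
  gen-cancel = from-yes (∀-pair? λ g → ∀-pair? λ x → ∀-pair? λ y → inGenE? g →-dec (((x *₄ g) ≟ₚ (y *₄ g)) →-dec (x ≟ₚ y)))

  unit-cancel : ∀ s e e' → e *₄ e' ≡ 1₄ → (s *₄ e') *₄ e ≡ s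
  unit-cancel = from-yes (∀-pair? λ s → ∀-pair? λ e → ∀-pair? λ e' → ((e *₄ e') ≟ₚ 1₄) →-dec (((s *₄ e') *₄ e) ≟ₚ s))

  -- {1, ψ} is a system of representatives of the regular elements modulo ℰ:
  -- every regular x is (pivot value)·e with e ∈ ℰ, and uniquely so.
  regular-normal-form : ∀ x → Regular x →
    ∃ λ e → ∃ λ e' → InGenE e × e *₄ e' ≡ 1₄ × PivotValue (x *₄ e')
  regular-normal-form = from-yes (∀-pair? λ x → regular? x →-dec
    ∃-pair? λ e → ∃-pair? λ e' → inGenE? e ×-dec (((e *₄ e') ≟ₚ 1₄) ×-dec pivotValue? (x *₄ e')))

  pivotValue-regular : ∀ a → PivotValue a → Regular a
  pivotValue-regular = from-yes (∀-pair? λ a → pivotValue? a →-dec regular? a)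

  pivot-scalar-unique : ∀ {a a'} → PivotValue a → PivotValue a' → ScalarDetermined a a'
  pivot-scalar-unique (inj₁ refl) (inj₁ refl) = from-yes (scalarDetermined? 1₄ 1₄)
  pivot-scalar-unique (inj₁ refl) (inj₂ refl) = from-yes (scalarDetermined? 1₄ ψ)
  pivot-scalar-unique (inj₂ refl) (inj₁ refl) = from-yes (scalarDetermined? ψ 1₄)
  pivot-scalar-unique (inj₂ refl) (inj₂ refl) = from-yes (scalarDetermined? ψ ψ)

  genK-nonzero : ∀ h → InGenK h → ¬ h ≡ 0₂
  genK-nonzero = from-yes (∀-pair? λ h → inGenK? h →-dec ¬? (h ≟ₚ 0₂))

  nonzero-genK : ∀ t → ¬ t ≡ 0₂ → InGenK t
  nonzero-genK = from-yes (∀-pair? λ t → ¬? (t ≟ₚ 0₂) →-dec inGenK? t)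

  nonzero-inverse : ∀ t → ¬ t ≡ 0₂ → ∃ λ t' → t *₂ t' ≡ 1₂
  nonzero-inverse = from-yes (∀-pair? λ t → ¬? (t ≟ₚ 0₂) →-dec ∃-pair? λ t' → (t *₂ t') ≟ₚ 1₂)

  genK-cancel : ∀ h x y → InGenK h → x *₂ h ≡ y *₂ h → x ≡ y
  genK-cancel = from-yes (∀-pair? λ h → ∀-pair? λ x → ∀-pair? λ y → inGenK? h →-dec (((x *₂ h) ≟ₚ (y *₂ h)) →-dec (x ≟ₚ y)))

  unit₂-cancel : ∀ t h h' → h *₂ h' ≡ 1₂ → (t *₂ h') *₂ h ≡ t
  unit₂-cancel = from-yes (∀-pair? λ t → ∀-pair? λ h → ∀-pair? λ h' → ((h *₂ h') ≟ₚ 1₂) →-dec (((t *₂ h') *₂ h) ≟ₚ t))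

module Dot {A : Set} (_+_ _*_ : A → A → A) (0# : A)
  (+-assoc : ∀ x y z → (x + y) + z ≡ x + (y + z))
  (+-comm : ∀ x y → x + y ≡ y + x)
  (+-identityˡ : ∀ x → 0# + x ≡ x)
  (*-distribˡ : ∀ c x y → c * (x + y) ≡ (c * x) + (c * y))
  (*-zeroʳ : ∀ c → c * 0# ≡ 0#)
  (*-left-comm : ∀ a c x → a * (c * x) ≡ c * (a * x)) where

  +-swapʳ : ∀ x y z → (x + y) + z ≡ (x + z) + y
  +-swapʳ x y z = begin
    (x + y) + z  ≡⟨ +-assoc x y z ⟩
    x + (y + z)  ≡⟨ cong (x +_) (+-comm y z) ⟩
    x + (z + y)  ≡⟨ +-assoc x z y ⟨
    (x + z) + y  ∎

  +-interchange : ∀ w x y z → (w + x) + (y + z) ≡ (w + y) + (x + z)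
  +-interchange w x y z = begin
    (w + x) + (y + z)  ≡⟨ +-assoc (w + x) y z ⟨
    ((w + x) + y) + z  ≡⟨ cong (_+ z) (+-swapʳ w x y) ⟩
    ((w + y) + x) + z  ≡⟨ +-assoc (w + y) x z ⟩
    (w + y) + (x + z)  ∎

  ∑ : ∀ {m} → (Fin m → A) → A
  ∑ f = foldr _ _+_ 0# (tabulate f)

  ∑-cong : ∀ {m} {f g : Fin m → A} → (∀ j → f j ≡ g j) → ∑ f ≡ ∑ g
  ∑-cong {zero} eq = refl
  ∑-cong {suc m} eq = cong₂ _+_ (eq zero) (∑-cong (eq ∘ suc))

  ∑-closed : (P : A → Set) → P 0# → (∀ x y → P x → P y → P (x + y)) →
             ∀ {m} (f : Fin m → A) → (∀ j → P (f j)) → P (∑ f)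
  ∑-closed P P0 P+ {zero} f Pf = P0
  ∑-closed P P0 P+ {suc m} f Pf = P+ _ _ (Pf zero) (∑-closed P P0 P+ (f ∘ suc) (Pf ∘ suc))

  ∑-distrib : ∀ {m} (f g : Fin m → A) → ∑ (λ j → f j + g j) ≡ ∑ f + ∑ g
  ∑-distrib {zero} f g = sym (+-identityˡ 0#)
  ∑-distrib {suc m} f g =
    trans (cong ((f zero + g zero) +_) (∑-distrib (f ∘ suc) (g ∘ suc)))
          (+-interchange (f zero) (g zero) (∑ (f ∘ suc)) (∑ (g ∘ suc)))

  ∑-scale : ∀ {m} c (f : Fin m → A) → ∑ (λ j → c * f j) ≡ c * ∑ f
  ∑-scale {zero} c f = sym (*-zeroʳ c)
  ∑-scale {suc m} c f =
    trans (cong ((c * f zero) +_) (∑-scale c (f ∘ suc))) (sym (*-distribˡ c (f zero) (∑ (f ∘ suc))))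

  ∑-shift : ∀ {m} (f g : Fin m → A) i d → (∀ j → i ≢ j → g j ≡ f j) → g i ≡ f i + d →
            ∑ g ≡ ∑ f + d
  ∑-shift {suc m} f g zero d others gᵢ =
    trans (cong₂ _+_ gᵢ (∑-cong (λ j → others (suc j) λ ())))
          (+-swapʳ (f zero) d (∑ (f ∘ suc)))
  ∑-shift {suc m} f g (suc i) d others gᵢ =
    trans (cong₂ _+_ (others zero λ ())
                     (∑-shift (f ∘ suc) (g ∘ suc) i d (λ j i≢j → others (suc j) (i≢j ∘ suc-injective)) gᵢ))
          (sym (+-assoc (f zero) (∑ (f ∘ suc)) d))

  _·_ : ∀ {m} → (Fin m → A) → Vec A m → A
  a · x = ∑ λ j → a j * lookup x j

  ·-zero : ∀ {m} (a : Fin m → A) → a · replicate m 0# ≡ 0#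
  ·-zero a = ∑-closed (_≡ 0#) refl (λ { _ _ refl refl → +-identityˡ 0# }) _
    (λ j → trans (cong (a j *_) (lookup-replicate j 0#)) (*-zeroʳ (a j)))

  ·-+ : ∀ {m} (a : Fin m → A) x x' → a · zipWith _+_ x x' ≡ (a · x) + (a · x')
  ·-+ a x x' = trans
    (∑-cong λ j → trans (cong (a j *_) (lookup-zipWith _+_ j x x')) (*-distribˡ (a j) _ _))
    (∑-distrib (λ j → a j * lookup x j) (λ j → a j * lookup x' j))

  ·-scale : ∀ {m} (a : Fin m → A) c x → a · map (c *_) x ≡ c * (a · x)
  ·-scale a c x = trans
    (∑-cong λ j → trans (cong (a j *_) (lookup-map j (c *_) x)) (*-left-comm (a j) c _))
    (∑-scale c (λ j → a j * lookup x j))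

  ·-shift : ∀ {m} (a : Fin m → A) x i d → a · updateAt x i (_+ d) ≡ (a · x) + (a i * d)
  ·-shift a x i d = ∑-shift (λ j → a j * lookup x j) _ i (a i * d)
    (λ j i≢j → cong (a j *_) (lookup∘updateAt′ j i (i≢j ∘ sym) x))
    (trans (cong (a i *_) (lookup∘updateAt i x)) (*-distribˡ (a i) _ d))

module D₄ = Dot _+₄_ _*₄_ 0₄ +₄-assoc +₄-comm +₄-identityˡ *₄-distribˡ *₄-zeroʳ *₄-left-comm
module D₂ = Dot _+₂_ _*₂_ 0₂ +₂-assoc +₂-comm +₂-identityˡ *₂-distribˡ *₂-zeroʳ *₂-left-comm
open D₄ using () renaming (_·_ to _·₄_)
open D₂ using () renaming (_·_ to _·₂_)

IsFirst : ∀ {k} → (Fin k → Set) → Fin k → Set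
IsFirst P p = P p × (∀ j → toℕ j < toℕ p → ¬ P j)

first-search : ∀ {k} {P : Fin k → Set} → Decidable P → (∀ j → ¬ P j) ⊎ Σ (Fin k) (IsFirst P)
first-search {zero} P? = inj₁ λ ()
first-search {suc k} P? with P? zero | first-search (P? ∘ suc)
... | yes P0 | _ = inj₂ (zero , P0 , λ j ())
... | no ¬P0 | inj₁ never = inj₁ λ { zero → ¬P0 ; (suc j) → never j }
... | no ¬P0 | inj₂ (p , Pp , before) =
  inj₂ (suc p , Pp , λ { zero _ → ¬P0 ; (suc j) (s≤s j<p) → before j j<p })

first-unique : ∀ {k} {P Q : Fin k → Set} {p q} → (∀ r → P r → Q r) → (∀ r → Q r → P r) →
               IsFirst P p → IsFirst Q q → p ≡ q
first-unique {p = p} {q} P⇒Q Q⇒P (Pp , beforeP) (Qq , beforeQ) with <-cmp p q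
... | tri< p<q _ _ = ⊥-elim (beforeQ p p<q (P⇒Q p Pp))
... | tri≈ _ p≡q _ = p≡q
... | tri> _ _ q<p = ⊥-elim (beforeP q q<p (Q⇒P q Qq))

vec-ext : ∀ {A : Set} {k} {xs ys : Vec A k} → (∀ r → lookup xs r ≡ lookup ys r) → xs ≡ ys
vec-ext {xs = xs} {ys} eq = begin
  xs                 ≡⟨ tabulate∘lookup xs ⟨
  tabulate (lookup xs) ≡⟨ tabulate-cong eq ⟩
  tabulate (lookup ys) ≡⟨ tabulate∘lookup ys ⟩
  ys                 ∎

updateAt-cancel : ∀ {A : Set} {k} (xs : Vec A k) i {f g : A → A} → (∀ a → g (f a) ≡ a) →
                  updateAt (updateAt xs i f) i g ≡ xs
updateAt-cancel xs i g∘f≡id = trans (updateAt-updateAt-local i xs (g∘f≡id _)) (updateAt-id i xs)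

-- The possible differences between a vertex and a codeword in its radius-1 ball.
data Error (m n : ℕ) : Set where
  none : Error m n
  shrikhande : Fin m → E4 → Error m n
  complete : Fin n → E2 → Error m n

Admissible : ∀ {m n} → Error m n → Set
Admissible none = ⊤
Admissible (shrikhande i g) = InGenE g
Admissible (complete j h) = InGenK h

correct : ∀ {m n} → Vertex m n → Error m n → Vertex m n
correct v none = v
correct (x , y) (shrikhande i g) = updateAt x i (_+₄ neg₄ g) , y
correct (x , y) (complete j h) = x , updateAt y j (_+₂ h)

module Syndromes {k m n : ℕ} (A : Fin m → Vec E4 k) (B : Fin n → Vec E2 k) where

  C : Vertex m n → Set
  C = CodeC k m n A B

  A*-row : Fin k → Fin m → E4
  A*-row r j = lookup (A j) r

  A'-row : Fin k → Fin n → E2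
  A'-row r j = lookup (B j) r

  syn : Vertex m n → Fin k → E4
  syn (x , y) r = A*-row r ·₄ x +₄ twice (A'-row r ·₂ y)

  codeword⇒syn≡0 : ∀ v → C v → ∀ r → syn v r ≡ 0₄
  codeword⇒syn≡0 v c r = begin
    syn v r                                  ≡⟨ lookup∘tabulate (syn v) r ⟨
    lookup (syndrome k m n A B v) r          ≡⟨ cong (λ s → lookup s r) c ⟩
    lookup (replicate k 0₄) r                ≡⟨ lookup-replicate r 0₄ ⟩
    0₄                                       ∎

  syn≡0⇒codeword : ∀ v → (∀ r → syn v r ≡ 0₄) → C v
  syn≡0⇒codeword v zero-syn = vec-ext λ r →
    trans (lookup∘tabulate (syn v) r) (trans (zero-syn r) (sym (lookup-replicate r 0₄)))

  syn-zero : ∀ r → syn (replicate m 0₄ , replicate n 0₂) r ≡ 0₄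
  syn-zero r = cong₂ (λ a b → a +₄ twice b) (D₄.·-zero (A*-row r)) (D₂.·-zero (A'-row r))

  syn-⊕ : ∀ u v r → syn (u ⊕ v) r ≡ syn u r +₄ syn v r
  syn-⊕ (x , y) (x' , y') r = begin
    a (zipWith _+₄_ x x') +₄ twice (b (zipWith _+₂_ y y'))
      ≡⟨ cong₂ (λ s t → s +₄ twice t) (D₄.·-+ (A*-row r) x x') (D₂.·-+ (A'-row r) y y') ⟩
    (a x +₄ a x') +₄ twice (b y +₂ b y')
      ≡⟨ cong ((a x +₄ a x') +₄_) (twice-+ (b y) (b y')) ⟩
    (a x +₄ a x') +₄ (twice (b y) +₄ twice (b y'))
      ≡⟨ D₄.+-interchange (a x) (a x') (twice (b y)) (twice (b y')) ⟩
    (a x +₄ twice (b y)) +₄ (a x' +₄ twice (b y'))  ∎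
    where
    a : Vec E4 m → E4
    a = A*-row r ·₄_
    b : Vec E2 n → E2
    b = A'-row r ·₂_

  syn-⊙ : ∀ c v r → syn (c ⊙ v) r ≡ c *₄ syn v r
  syn-⊙ c (x , y) r = begin
    a (map (c *₄_) x) +₄ twice (b (map (red c *₂_) y))
      ≡⟨ cong₂ (λ s t → s +₄ twice t) (D₄.·-scale (A*-row r) c x) (D₂.·-scale (A'-row r) (red c) y) ⟩
    c *₄ a x +₄ twice (red c *₂ b y)
      ≡⟨ cong (c *₄ a x +₄_) (twice-scale c (b y)) ⟩
    c *₄ a x +₄ c *₄ twice (b y)
      ≡⟨ *₄-distribˡ c (a x) (twice (b y)) ⟨
    c *₄ (a x +₄ twice (b y))  ∎
    where
    a : Vec E4 m → E4
    a = A*-row r ·₄_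
    b : Vec E2 n → E2
    b = A'-row r ·₂_

  linear : IsLinear C
  linear = syn≡0⇒codeword (replicate m 0₄ , replicate n 0₂) syn-zero
         , (λ u v cu cv → syn≡0⇒codeword (u ⊕ v) λ r →
              trans (syn-⊕ u v r) (cong₂ _+₄_ (codeword⇒syn≡0 u cu r) (codeword⇒syn≡0 v cv r)))
         , (λ c v cv → syn≡0⇒codeword (c ⊙ v) λ r →
              trans (syn-⊙ c v r) (trans (cong (c *₄_) (codeword⇒syn≡0 v cv r)) (*₄-zeroʳ c)))

  errSyn : Error m n → Fin k → E4
  errSyn none r = 0₄
  errSyn (shrikhande i g) r = lookup (A i) r *₄ g
  errSyn (complete j h) r = twice (lookup (B j) r *₂ h)

  syn-shift* : ∀ x y i d r → syn (updateAt x i (_+₄ d) , y) r ≡ syn (x , y) r +₄ lookup (A i) r *₄ d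
  syn-shift* x y i d r =
    trans (cong (_+₄ twice (A'-row r ·₂ y)) (D₄.·-shift (A*-row r) x i d))
          (D₄.+-swapʳ (A*-row r ·₄ x) (lookup (A i) r *₄ d) (twice (A'-row r ·₂ y)))

  syn-shift' : ∀ x y j h r → syn (x , updateAt y j (_+₂ h)) r ≡ syn (x , y) r +₄ twice (lookup (B j) r *₂ h)
  syn-shift' x y j h r = begin
    a +₄ twice (A'-row r ·₂ updateAt y j (_+₂ h))
      ≡⟨ cong (λ t → a +₄ twice t) (D₂.·-shift (A'-row r) y j h) ⟩
    a +₄ twice (b +₂ lookup (B j) r *₂ h)
      ≡⟨ cong (a +₄_) (twice-+ b (lookup (B j) r *₂ h)) ⟩
    a +₄ (twice b +₄ twice (lookup (B j) r *₂ h))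
      ≡⟨ +₄-assoc a (twice b) (twice (lookup (B j) r *₂ h)) ⟨
    (a +₄ twice b) +₄ twice (lookup (B j) r *₂ h)  ∎
    where
    a : E4
    a = A*-row r ·₄ x
    b : E2
    b = A'-row r ·₂ y

  Decoded : Vertex m n → Set
  Decoded v = Σ (Error m n) λ e → Admissible e × (∀ r → syn v r ≡ errSyn e r)

  correction-valid : ∀ v e → Admissible e → (∀ r → syn v r ≡ errSyn e r) →
                     C (correct v e) × InBall1 (correct v e) v
  correction-valid v none _ s = syn≡0⇒codeword v s , inj₁ refl
  correction-valid (x , y) (shrikhande i g) g∈ℰ s =
    syn≡0⇒codeword (updateAt x i (_+₄ neg₄ g) , y) (λ r → begin
      syn (updateAt x i (_+₄ neg₄ g) , y) r          ≡⟨ syn-shift* x y i (neg₄ g) r ⟩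
      syn (x , y) r +₄ lookup (A i) r *₄ neg₄ g      ≡⟨ cong (_+₄ lookup (A i) r *₄ neg₄ g) (s r) ⟩
      lookup (A i) r *₄ g +₄ lookup (A i) r *₄ neg₄ g ≡⟨ *₄-neg-cancel (lookup (A i) r) g ⟩
      0₄                                              ∎)
    , inj₂ (inj₁ (i , g , g∈ℰ , sym (updateAt-cancel x i (λ a → neg-+₄-cancel a g)) , refl))
  correction-valid (x , y) (complete j h) h∈K s =
    syn≡0⇒codeword (x , updateAt y j (_+₂ h)) (λ r → begin
      syn (x , updateAt y j (_+₂ h)) r                  ≡⟨ syn-shift' x y j h r ⟩
      syn (x , y) r +₄ twice (lookup (B j) r *₂ h)      ≡⟨ cong (_+₄ twice (lookup (B j) r *₂ h)) (s r) ⟩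
      twice (lookup (B j) r *₂ h) +₄ twice (lookup (B j) r *₂ h) ≡⟨ twice-self-cancel (lookup (B j) r *₂ h) ⟩
      0₄                                                 ∎)
    , inj₂ (inj₂ (j , h , h∈K , sym (updateAt-cancel y j (λ a → +₂-self-cancel a h)) , refl))

  ball-error : ∀ {c v} → C c → InBall1 c v → Σ (Decoded v) λ d → c ≡ correct v (proj₁ d)
  ball-error {c} cc (inj₁ refl) = (none , tt , codeword⇒syn≡0 c cc) , refl
  ball-error {x , y} cc (inj₂ (inj₁ (i , g , g∈ℰ , refl , refl))) =
    (shrikhande i g , g∈ℰ
    , (λ r → trans (syn-shift* x y i g r)
               (trans (cong (_+₄ lookup (A i) r *₄ g) (codeword⇒syn≡0 (x , y) cc r)) (+₄-identityˡ (lookup (A i) r *₄ g)))))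
    , cong (_, y) (sym (updateAt-cancel x i (λ a → +₄-neg-cancel a g)))
  ball-error {x , y} cc (inj₂ (inj₂ (j , h , h∈K , refl , refl))) =
    (complete j h , h∈K
    , (λ r → trans (syn-shift' x y j h r)
               (trans (cong (_+₄ twice (lookup (B j) r *₂ h)) (codeword⇒syn≡0 (x , y) cc r)) (+₄-identityˡ (twice (lookup (B j) r *₂ h))))))
    , cong (x ,_) (sym (updateAt-cancel y j (λ a → +₂-self-cancel a h)))

normalised-A*-column : ∀ γ δ (s : Fin (γ + δ) → E4) p e' →
  (∀ j → toℕ j < toℕ p → ZeroDivisor (s j)) → PivotValue (s p *₄ e') →
  (∀ r → δ ≤ toℕ r → ZeroDivisor (s r)) → ValidColA* γ δ (tabulate λ r → s r *₄ e')
normalised-A*-column γ δ s p e' before normal tail =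
  (p , pivotValue-regular (lookup column p) normal′ , (λ j j<p → entry-zeroDivisor j (before j j<p)) , normal′)
  , λ j δ≤j → entry-zeroDivisor j (tail j δ≤j)
  where
  column : Vec E4 (γ + δ)
  column = tabulate λ r → s r *₄ e'
  normal′ : PivotValue (lookup column p)
  normal′ = subst PivotValue (sym (lookup∘tabulate (λ r → s r *₄ e') p)) normal
  entry-zeroDivisor : ∀ j → ZeroDivisor (s j) → ZeroDivisor (lookup column j)
  entry-zeroDivisor j zd = subst ZeroDivisor (sym (lookup∘tabulate (λ r → s r *₄ e') j)) (zeroDivisor-*ʳ (s j) e' zd)

normalised-A'-column : ∀ γ δ (t : Fin (γ + δ) → E2) p t' →
  (∀ j → toℕ j < toℕ p → t j ≡ 0₂) → t p *₂ t' ≡ 1₂ → ValidColA' γ δ (tabulate λ r → t r *₂ t')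
normalised-A'-column γ δ t p t' before inverse =
  p , trans (lookup∘tabulate (λ r → t r *₂ t') p) inverse
  , λ j j<p → trans (lookup∘tabulate (λ r → t r *₂ t') j) (trans (cong (_*₂ t') (before j j<p)) (*₂-zeroˡ t'))

module Decoding (γ δ : ℕ) {m n : ℕ} (A : Fin m → Vec E4 (γ + δ)) (B : Fin n → Vec E2 (γ + δ))
  (enumA : ColumnsEnumerate m (ValidColA* γ δ) A)
  (enumB : ColumnsEnumerate n (ValidColA' γ δ) B) where

  open Syndromes A B

  A-injective : ∀ i i' → A i ≡ A i' → i ≡ i'
  A-injective = proj₁ enumA

  A-valid : ∀ i → ValidColA* γ δ (A i)
  A-valid = proj₁ (proj₂ enumA)

  A-complete : ∀ a → ValidColA* γ δ a → ∃ λ i → A i ≡ a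
  A-complete = proj₂ (proj₂ enumA)

  B-injective : ∀ j j' → B j ≡ B j' → j ≡ j'
  B-injective = proj₁ enumB

  B-valid : ∀ j → ValidColA' γ δ (B j)
  B-valid = proj₁ (proj₂ enumB)

  B-complete : ∀ b → ValidColA' γ δ b → ∃ λ j → B j ≡ b
  B-complete = proj₂ (proj₂ enumB)

  pivot : Fin m → Fin (γ + δ)
  pivot i = proj₁ (proj₁ (A-valid i))

  pivot-value : ∀ i → PivotValue (lookup (A i) (pivot i))
  pivot-value i = proj₂ (proj₂ (proj₂ (proj₁ (A-valid i))))

  shrikhande-pivot : ∀ i g → InGenE g → IsFirst (λ r → Regular (errSyn (shrikhande i g) r)) (pivot i)
  shrikhande-pivot i g g∈ℰ =
    regular-*-gen (lookup (A i) (pivot i)) g (proj₁ (proj₂ (proj₁ (A-valid i)))) g∈ℰ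
    , λ j j<p regular → regular (zeroDivisor-*ʳ (lookup (A i) j) g (proj₁ (proj₂ (proj₂ (proj₁ (A-valid i)))) j j<p))

  leader : Fin n → Fin (γ + δ)
  leader j = proj₁ (B-valid j)

  leader-one : ∀ j → lookup (B j) (leader j) ≡ 1₂
  leader-one j = proj₁ (proj₂ (B-valid j))

  complete-leader : ∀ j h → InGenK h → IsFirst (λ r → ¬ lookup (B j) r *₂ h ≡ 0₂) (leader j)
  complete-leader j h h∈K =
    (λ leader≡0 → genK-nonzero h h∈K (begin
       h                            ≡⟨ *₂-identityˡ h ⟨
       1₂ *₂ h                      ≡⟨ cong (_*₂ h) (leader-one j) ⟨
       lookup (B j) (leader j) *₂ h ≡⟨ leader≡0 ⟩
       0₂                           ∎))
    , λ j' j'<l nonzero → nonzero (trans (cong (_*₂ h) (proj₂ (proj₂ (B-valid j)) j' j'<l)) (*₂-zeroˡ h))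

  none≢shrikhande : ∀ {i g} → InGenE g → ¬ (∀ r → errSyn none r ≡ errSyn (shrikhande i g) r)
  none≢shrikhande {i} {g} g∈ℰ s =
    proj₁ (shrikhande-pivot i g g∈ℰ) (subst ZeroDivisor (s (pivot i)) (inj₁ refl))

  none≢complete : ∀ {j h} → InGenK h → ¬ (∀ r → errSyn none r ≡ errSyn (complete j h) r)
  none≢complete {j} {h} h∈K s =
    proj₁ (complete-leader j h h∈K) (sym (twice-injective 0₂ (lookup (B j) (leader j) *₂ h) (s (leader j))))

  shrikhande≢complete : ∀ {i g j h} → InGenE g → ¬ (∀ r → errSyn (shrikhande i g) r ≡ errSyn (complete j h) r)
  shrikhande≢complete {i} {g} {j} {h} g∈ℰ s =
    proj₁ (shrikhande-pivot i g g∈ℰ)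
      (subst ZeroDivisor (sym (s (pivot i))) (twice-zeroDivisor (lookup (B j) (pivot i) *₂ h)))

  -- A Shrikhande error is determined by its syndrome: the pivot is recovered as
  -- the first regular entry, then the generator from the value there.
  shrikhande-unique : ∀ {i g i' g'} → InGenE g → InGenE g' →
    (∀ r → errSyn (shrikhande i g) r ≡ errSyn (shrikhande i' g') r) → shrikhande i g ≡ shrikhande i' g'
  shrikhande-unique {i} {g} {i'} {g'} g∈ℰ g'∈ℰ s = cong₂ (shrikhande {m} {n}) i≡i' g≡g'
    where
    same-pivot : pivot i ≡ pivot i'
    same-pivot = first-unique (λ r → subst Regular (s r)) (λ r → subst Regular (sym (s r)))
                   (shrikhande-pivot i g g∈ℰ) (shrikhande-pivot i' g' g'∈ℰ)
    g≡g' : g ≡ g'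
    g≡g' = pivot-scalar-unique (pivot-value i)
             (subst (λ q → PivotValue (lookup (A i') q)) (sym same-pivot) (pivot-value i'))
             g g' g∈ℰ g'∈ℰ (s (pivot i))
    i≡i' : i ≡ i'
    i≡i' = A-injective i i' (vec-ext λ r →
             gen-cancel g (lookup (A i) r) (lookup (A i') r) g∈ℰ (trans (s r) (cong (lookup (A i') r *₄_) (sym g≡g'))))

  -- A K-error is determined by its syndrome: the leader is recovered as the
  -- first nonzero entry of the halved syndrome, then the scalar from the value there.
  complete-unique : ∀ {j h j' h'} → InGenK h → InGenK h' →
    (∀ r → errSyn (complete j h) r ≡ errSyn (complete j' h') r) → complete j h ≡ complete j' h'
  complete-unique {j} {h} {j'} {h'} h∈K h'∈K s = cong₂ (complete {m} {n}) j≡j' h≡h'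
    where
    halves : ∀ r → lookup (B j) r *₂ h ≡ lookup (B j') r *₂ h'
    halves r = twice-injective (lookup (B j) r *₂ h) (lookup (B j') r *₂ h') (s r)
    same-leader : leader j ≡ leader j'
    same-leader = first-unique (λ r nonzero eq → nonzero (trans (halves r) eq))
                               (λ r nonzero eq → nonzero (trans (sym (halves r)) eq))
                               (complete-leader j h h∈K) (complete-leader j' h' h'∈K)
    h≡h' : h ≡ h'
    h≡h' = begin
      h                                ≡⟨ *₂-identityˡ h ⟨
      1₂ *₂ h                          ≡⟨ cong (_*₂ h) (leader-one j) ⟨
      lookup (B j) (leader j) *₂ h     ≡⟨ halves (leader j) ⟩
      lookup (B j') (leader j) *₂ h'   ≡⟨ cong (λ q → lookup (B j') q *₂ h') same-leader ⟩
      lookup (B j') (leader j') *₂ h'  ≡⟨ cong (_*₂ h') (leader-one j') ⟩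
      1₂ *₂ h'                         ≡⟨ *₂-identityˡ h' ⟩
      h'                               ∎
    j≡j' : j ≡ j'
    j≡j' = B-injective j j' (vec-ext λ r →
             genK-cancel h (lookup (B j) r) (lookup (B j') r) h∈K (trans (halves r) (cong (lookup (B j') r *₂_) (sym h≡h'))))

  errSyn-injective : ∀ {e e'} → Admissible e → Admissible e' → (∀ r → errSyn e r ≡ errSyn e' r) → e ≡ e'
  errSyn-injective {none} {none} _ _ _ = refl
  errSyn-injective {none} {shrikhande i g} _ g∈ℰ s = ⊥-elim (none≢shrikhande {i} {g} g∈ℰ s)
  errSyn-injective {none} {complete j h} _ h∈K s = ⊥-elim (none≢complete {j} {h} h∈K s)
  errSyn-injective {shrikhande i g} {none} g∈ℰ _ s = ⊥-elim (none≢shrikhande {i} {g} g∈ℰ (sym ∘ s))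
  errSyn-injective {shrikhande i g} {shrikhande i' g'} g∈ℰ g'∈ℰ s = shrikhande-unique {i} {g} {i'} {g'} g∈ℰ g'∈ℰ s
  errSyn-injective {shrikhande i g} {complete j h} g∈ℰ _ s = ⊥-elim (shrikhande≢complete {i} {g} {j} {h} g∈ℰ s)
  errSyn-injective {complete j h} {none} h∈K _ s = ⊥-elim (none≢complete {j} {h} h∈K (sym ∘ s))
  errSyn-injective {complete j h} {shrikhande i g} _ g∈ℰ s = ⊥-elim (shrikhande≢complete {i} {g} {j} {h} g∈ℰ (sym ∘ s))
  errSyn-injective {complete j h} {complete j' h'} h∈K h'∈K s = complete-unique {j} {h} {j'} {h'} h∈K h'∈K s

  syn-tail : ∀ v r → δ ≤ toℕ r → ZeroDivisor (syn v r)
  syn-tail (x , y) r δ≤r =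
    zeroDivisor-+ (A*-row r ·₄ x) (twice (A'-row r ·₂ y))
      (D₄.∑-closed ZeroDivisor (inj₁ refl) zeroDivisor-+ (λ j → A*-row r j *₄ lookup x j)
         (λ j → zeroDivisor-*ʳ (A*-row r j) (lookup x j) (proj₂ (A-valid j) r δ≤r)))
      (twice-zeroDivisor (A'-row r ·₂ y))

  -- A syndrome with a regular entry is that of a Shrikhande error: normalise it
  -- at its first regular entry and find the resulting column in A*.
  decode-regular : ∀ v p → IsFirst (λ r → Regular (syn v r)) p → Decoded v
  decode-regular v p (regular , before) = from-normal-form (regular-normal-form (syn v p) regular)
    where
    from-normal-form : (∃ λ e → ∃ λ e' → InGenE e × e *₄ e' ≡ 1₄ × PivotValue (syn v p *₄ e')) → Decoded v
    from-normal-form (e , e' , e∈ℰ , ee'≡1 , normal) = shrikhande i e , e∈ℰ , λ r → begin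
      syn v r                     ≡⟨ unit-cancel (syn v r) e e' ee'≡1 ⟨
      (syn v r *₄ e') *₄ e        ≡⟨ cong (_*₄ e) (lookup∘tabulate scaled r) ⟨
      lookup column r *₄ e        ≡⟨ cong (λ c → lookup c r *₄ e) Ai≡column ⟨
      lookup (A i) r *₄ e         ∎
      where
      scaled : Fin (γ + δ) → E4
      scaled r = syn v r *₄ e'
      column : Vec E4 (γ + δ)
      column = tabulate scaled
      found : ∃ λ i → A i ≡ column
      found = A-complete column (normalised-A*-column γ δ (syn v) p e'
                (λ j j<p → ¬regular⇒zeroDivisor (syn v j) (before j j<p)) normal (syn-tail v))
      i : Fin m
      i = proj₁ found
      Ai≡column : A i ≡ column
      Ai≡column = proj₂ found

  -- A syndrome 2t is that of no error (t = 0) or of a K-error: normalise t at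
  -- its first nonzero entry and find the resulting column in A'.
  decode-twice : ∀ v (t : Fin (γ + δ) → E2) → (∀ r → syn v r ≡ twice (t r)) → Decoded v
  decode-twice v t s = by-first-nonzero (first-search (λ r → ¬? (t r ≟ₚ 0₂)))
    where
    by-first-nonzero : (∀ r → ¬ ¬ t r ≡ 0₂) ⊎ Σ (Fin (γ + δ)) (IsFirst (λ r → ¬ t r ≡ 0₂)) → Decoded v
    by-first-nonzero (inj₁ all-zero) =
      none , tt , λ r → trans (s r) (cong twice (decidable-stable (t r ≟ₚ 0₂) (all-zero r)))
    by-first-nonzero (inj₂ (p , t≢0 , before)) = from-inverse (nonzero-inverse (t p) t≢0)
      where
      from-inverse : (∃ λ t' → t p *₂ t' ≡ 1₂) → Decoded v
      from-inverse (t' , tt'≡1) = complete j (t p) , nonzero-genK (t p) t≢0 , λ r → begin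
        syn v r                       ≡⟨ s r ⟩
        twice (t r)                   ≡⟨ cong twice (unit₂-cancel (t r) (t p) t' tt'≡1) ⟨
        twice ((t r *₂ t') *₂ t p)    ≡⟨ cong (λ u → twice (u *₂ t p)) (lookup∘tabulate scaled r) ⟨
        twice (lookup column r *₂ t p) ≡⟨ cong (λ c → twice (lookup c r *₂ t p)) Bj≡column ⟨
        twice (lookup (B j) r *₂ t p) ∎
        where
        scaled : Fin (γ + δ) → E2
        scaled r = t r *₂ t'
        column : Vec E2 (γ + δ)
        column = tabulate scaled
        found : ∃ λ j → B j ≡ column
        found = B-complete column (normalised-A'-column γ δ t p t'
                  (λ j j<p → decidable-stable (t j ≟ₚ 0₂) (before j j<p)) tt'≡1)
        j : Fin n
        j = proj₁ found
        Bj≡column : B j ≡ column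
        Bj≡column = proj₂ found

  -- Every vertex has a decoding: by its first regular syndrome entry if there
  -- is one, and otherwise its syndrome is 2t for t the halved syndrome.
  decode : ∀ v → Decoded v
  decode v = by-first-regular (first-search (λ r → regular? (syn v r)))
    where
    by-first-regular : (∀ r → ¬ Regular (syn v r)) ⊎ Σ (Fin (γ + δ)) (IsFirst (λ r → Regular (syn v r))) →
                       Decoded v
    by-first-regular (inj₂ (p , first)) = decode-regular v p first
    by-first-regular (inj₁ no-regular) = decode-twice v (λ r → half (syn v r)) λ r →
      sym (twice-half (syn v r) (¬regular⇒zeroDivisor (syn v r) (no-regular r)))

  decoding-unique : ∀ v (d d' : Decoded v) → proj₁ d ≡ proj₁ d'
  decoding-unique v (e , admissible , s) (e' , admissible' , s') =
    errSyn-injective admissible admissible' λ r → trans (sym (s r)) (s' r)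

  -- Every vertex is within distance 1 of a codeword (remove its decoded error),
  -- and of only one: both are obtained by removing the unique decoded error.
  perfect : IsPerfect1 C
  perfect v = covered (decode v) , unique
    where
    covered : Decoded v → ∃ λ c → C c × InBall1 c v
    covered (e , admissible , s) = correct v e , correction-valid v e admissible s
    unique : ∀ c c' → C c → C c' → InBall1 c v → InBall1 c' v → c ≡ c'
    unique c c' cc cc' b b' = begin
      c                             ≡⟨ proj₂ via-c ⟩
      correct v (proj₁ (proj₁ via-c))  ≡⟨ cong (correct v) (decoding-unique v (proj₁ via-c) (proj₁ via-c')) ⟩
      correct v (proj₁ (proj₁ via-c')) ≡⟨ proj₂ via-c' ⟨
      c'                            ∎
      where
      via-c : Σ (Decoded v) λ d → c ≡ correct v (proj₁ d)
      via-c = ball-error cc b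
      via-c' : Σ (Decoded v) λ d → c' ≡ correct v (proj₁ d)
      via-c' = ball-error cc' b'

-- The hypothesis δ > 0 only guarantees that the sizes m and n count the
-- admissible columns; the argument uses the enumerations themselves.
theorem2 : (γ δ : ℕ) → 0 < δ →
    (colA* : Fin (mSize γ δ) → Vec E4 (γ + δ)) →
    (colA' : Fin (nSize γ δ) → Vec E2 (γ + δ)) →
    ColumnsEnumerate (mSize γ δ) (ValidColA* γ δ) colA* →
    ColumnsEnumerate (nSize γ δ) (ValidColA' γ δ) colA' →
    IsLinear (CodeC (γ + δ) (mSize γ δ) (nSize γ δ) colA* colA') ×
    IsPerfect1 (CodeC (γ + δ) (mSize γ δ) (nSize γ δ) colA* colA')
theorem2 γ δ _ colA* colA' enumA enumB =
  Syndromes.linear colA* colA' , Decoding.perfect γ δ colA* colA' enumA enumB
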